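{- Let $n\ge3$ and let $C_n$ be a directed cycle graph with two opposite paths: with vertices labeled $v_0,v_1,\dots,v_{n-1}$ in cyclic order, there are integers $p,q\ge1$ with $p+q\le n$ such that $C_n$ has one-directional arrows $v_i\to v_{i-1}$ for $1\le i\le p$ and $v_{n-j}\to v_{n-j+1}$ for $1\le j\le q$ (where $v_n:=v_0$), and all other arrows of $C_n$ are bi-directional. Let $k$ be the number of bi-directional arrows of $C_n$ (so $k=n-p-q$). Then $\operatorname{Pic}(C_n)\cong\mathbb{Z}\times\mathbb{Z}_{k+2}$ and $\operatorname{Jac}(C_n)\cong\mathbb{Z}_{k+2}$.
   Context: A directed cycle graph on $n$ vertices has, for each cyclically consecutive pair of vertices, exactly one arrow, either one-directional or bi-directional; a bi-directional arrow between $u,w$ counts as an arrow from $u$ to $w$ and one from $w$ to $u$. The Laplacian $L_G$ of a directed graph $G$ on $n$ vertices is the $n\times n$ integer matrix with $(i,i)$ entry the number of outgoing arrows of the $i$th vertex and $(i,j)$ entry ($i\ne j$) minus the number of arrows from the $i$th to the $j$th vertex. $\operatorname{Pic}(G)=\mathbb{Z}^n/L_G^T\mathbb{Z}^n$, $\operatorname{Jac}(G)$ is its torsion subgroup, $\mathbb{Z}_m=\mathbb{Z}/m\mathbb{Z}$. -}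

module Defs where

open import Level using (Level; 0ℓ)
open import Data.Bool using (Bool; true; false; _∧_; _∨_; if_then_else_)
open import Data.Nat as ℕ using (ℕ; zero; suc; _≡ᵇ_; _<ᵇ_; _∸_)
open import Data.Fin using (Fin; toℕ) renaming (zero to fz; suc to fs)
open import Relation.Nullary using (yes; no)
open import Data.Integer as ℤ using (ℤ; +_; _+_; _-_; _*_; -_)
open import Data.Integer.Properties as ℤP using (+-0-abelianGroup)
open import Data.Integer.Divisibility.Signed using (_∣_; divides; ∣-refl; ∣-reflexive; ∣m∣n⇒∣m+n; ∣m⇒∣-m)
open import Data.Integer.Tactic.RingSolver using (solve-∀)
open import Data.Product using (Σ; ∃; _×_; _,_)
open import Function.Bundles using (_⇔_)
open import Relation.Binary.PropositionalEquality using (_≡_; refl; subst; sym)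
open import Algebra.Bundles using (AbelianGroup)
import Algebra.Construct.DirectProduct as DP

sumℤ : ∀ {n} → (Fin n → ℤ) → ℤ
sumℤ {zero}  f = + 0
sumℤ {suc n} f = f fz + sumℤ (λ i → f (fs i))

-- For each i, the cyclically
-- consecutive pair (v_i , v_{i+1 mod n}) carries exactly one arrow:
--   fwd : v_i → v_{i+1}     bwd : v_{i+1} → v_i     bi : both

data Arrow : Set where
  fwd bwd bi : Arrow

DirCycle : ℕ → Set
DirCycle n = Fin n → Arrow

isNext : ∀ {n} → Fin n → Fin n → Bool
isNext {n} i j = (suc (toℕ i) ≡ᵇ toℕ j) ∨ ((suc (toℕ i) ≡ᵇ n) ∧ (toℕ j ≡ᵇ 0))

goesFwd : Arrow → Bool
goesFwd fwd = true
goesFwd bwd = false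
goesFwd bi  = true

goesBwd : Arrow → Bool
goesBwd fwd = false
goesBwd bwd = true
goesBwd bi  = true

bit : Bool → ℕ
bit true  = 1
bit false = 0

-- number of arrows from vertex i to vertex j (for n ≥ 3)
arrows : ∀ {n} → DirCycle n → Fin n → Fin n → ℕ
arrows G i j = bit (isNext i j ∧ goesFwd (G i)) ℕ.+ bit (isNext j i ∧ goesBwd (G j))

outdeg : ∀ {n} → DirCycle n → Fin n → ℤ
outdeg G i = sumℤ (λ j → + arrows G i j)

laplacian : ∀ {n} → DirCycle n → Fin n → Fin n → ℤ
laplacian G i j with toℕ i ℕ.≟ toℕ j
... | yes _ = outdeg G i
... | no  _ = - (+ arrows G i j)

isBi : Arrow → Bool
isBi bi = true
isBi _  = false

numBi : ∀ {n} → DirCycle n → ℕ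
numBi {n} G = sumℕ (λ e → bit (isBi (G e)))
  where
  sumℕ : ∀ {m} → (Fin m → ℕ) → ℕ
  sumℕ {zero}  f = 0
  sumℕ {suc m} f = f fz ℕ.+ sumℕ (λ i → f (fs i))

-- The directed cycle graph with two opposite paths:
-- arrows v_i → v_{i-1} for 1 ≤ i ≤ p (pairs (v_e,v_{e+1}) with e < p),
-- arrows v_{n-j} → v_{n-j+1} for 1 ≤ j ≤ q (pairs with e ≥ n - q),
-- all other arrows bi-directional.
twoOpposite : (n p q : ℕ) → DirCycle n
twoOpposite n p q e =
  if toℕ e <ᵇ p then bwd else (if (n ∸ q) ℕ.≤ᵇ toℕ e then fwd else bi)

-- Pic(G) = ℤ^n / L_G^T ℤ^n  and  Jac(G) = torsion of Pic(G).
-- Quotients are not types here, so "Pic(G) ≅ H" is expressed by an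
-- explicit group isomorphism  ℤ^n / L^T ℤ^n → H, i.e. a homomorphism
-- ℤ^n → H that is surjective and whose kernel is exactly L^T ℤ^n.

Vecℤ : ℕ → Set
Vecℤ n = Fin n → ℤ

_⊕_ : ∀ {n} → Vecℤ n → Vecℤ n → Vecℤ n
(x ⊕ y) i = x i + y i

scale : ∀ {n} → ℤ → Vecℤ n → Vecℤ n
scale c x i = c * x i

InImageLT : ∀ {n} → (Fin n → Fin n → ℤ) → Vecℤ n → Set
InImageLT {n} L x = Σ (Vecℤ n) λ y → ∀ j → x j ≡ sumℤ (λ i → L i j * y i)

IsTorsion : ∀ {n} → (Fin n → Fin n → ℤ) → Vecℤ n → Set
IsTorsion L x = Σ ℕ λ d → InImageLT L (scale (+ suc d) x)

record PicIso {a ℓ} (n : ℕ) (L : Fin n → Fin n → ℤ) (H : AbelianGroup a ℓ) : Set (a Level.⊔ ℓ) where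
  open AbelianGroup H
  field
    φ          : Vecℤ n → Carrier
    hom        : ∀ x y → φ (x ⊕ y) ≈ φ x ∙ φ y
    surjective : ∀ h → Σ (Vecℤ n) λ x → φ x ≈ h
    kernel     : ∀ x → (φ x ≈ ε) ⇔ InImageLT L x

record JacIso {a ℓ} (n : ℕ) (L : Fin n → Fin n → ℤ) (H : AbelianGroup a ℓ) : Set (a Level.⊔ ℓ) where
  open AbelianGroup H
  field
    φ          : (x : Vecℤ n) → IsTorsion L x → Carrier
    irrelevant : ∀ x (t t′ : IsTorsion L x) → φ x t ≈ φ x t′
    hom        : ∀ x y tx ty txy → φ (x ⊕ y) txy ≈ φ x tx ∙ φ y ty
    surjective : ∀ h → Σ (Vecℤ n) λ x → Σ (IsTorsion L x) λ t → φ x t ≈ h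
    kernel     : ∀ x t → (φ x t ≈ ε) ⇔ InImageLT L x

Pic≅ : ∀ {a ℓ} {n} → DirCycle n → AbelianGroup a ℓ → Set (a Level.⊔ ℓ)
Pic≅ {n = n} G H = PicIso n (laplacian G) H

Jac≅ : ∀ {a ℓ} {n} → DirCycle n → AbelianGroup a ℓ → Set (a Level.⊔ ℓ)
Jac≅ {n = n} G H = JacIso n (laplacian G) H

ℤ-group : AbelianGroup 0ℓ 0ℓ
ℤ-group = +-0-abelianGroup

module _ (m : ℕ) where
  private
    _≈_ : ℤ → ℤ → Set
    a ≈ b = (+ m) ∣ (a - b)

    l1 : ∀ a b → b - a ≡ - (a - b)
    l1 = solve-∀
    l2 : ∀ a b c → a - c ≡ (a - b) + (b - c)
    l2 = solve-∀
    l3 : ∀ a b c d → (a + c) - (b + d) ≡ (a - b) + (c - d)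
    l3 = solve-∀
    l4 : ∀ a b → (- a) - (- b) ≡ - (a - b)
    l4 = solve-∀

    refl≈ : ∀ {a} → a ≈ a
    refl≈ {a} = subst ((+ m) ∣_) (sym (ℤP.+-inverseʳ a)) (∣-reflexive-0)
      where
      ∣-reflexive-0 : (+ m) ∣ (+ 0)
      ∣-reflexive-0 = divides (+ 0) (sym (ℤP.*-zeroˡ (+ m)))

    ≈from≡ : ∀ {a b} → a ≡ b → a ≈ b
    ≈from≡ {a} refl = refl≈ {a}

    sym≈ : ∀ {a b} → a ≈ b → b ≈ a
    sym≈ {a} {b} p = subst ((+ m) ∣_) (sym (l1 a b)) (∣m⇒∣-m p)

    trans≈ : ∀ {a b c} → a ≈ b → b ≈ c → a ≈ c
    trans≈ {a} {b} {c} p q = subst ((+ m) ∣_) (sym (l2 a b c)) (∣m∣n⇒∣m+n p q)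

    +cong : ∀ {a b c d} → a ≈ b → c ≈ d → (a + c) ≈ (b + d)
    +cong {a} {b} {c} {d} p q = subst ((+ m) ∣_) (sym (l3 a b c d)) (∣m∣n⇒∣m+n p q)

    -cong : ∀ {a b} → a ≈ b → (- a) ≈ (- b)
    -cong {a} {b} p = subst ((+ m) ∣_) (sym (l4 a b)) (∣m⇒∣-m p)

  ℤmod : AbelianGroup 0ℓ 0ℓ
  ℤmod = record
    { Carrier = ℤ
    ; _≈_ = _≈_
    ; _∙_ = _+_
    ; ε = + 0
    ; _⁻¹ = -_
    ; isAbelianGroup = record
      { isGroup = record
        { isMonoid = record
          { isSemigroup = record
            { isMagma = record
              { isEquivalence = record { refl = λ {a} → refl≈ {a} ; sym = λ {a} {b} → sym≈ {a} {b} ; trans = λ {a} {b} {c} → trans≈ {a} {b} {c} }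
              ; ∙-cong = λ {a} {b} {c} {d} → +cong {a} {b} {c} {d} }
            ; assoc = λ a b c → ≈from≡ (ℤP.+-assoc a b c) }
          ; identity = (λ a → ≈from≡ (ℤP.+-identityˡ a)) , (λ a → ≈from≡ (ℤP.+-identityʳ a)) }
        ; inverse = (λ a → ≈from≡ (ℤP.+-inverseˡ a)) , (λ a → ≈from≡ (ℤP.+-inverseʳ a))
        ; ⁻¹-cong = λ {a} {b} → -cong {a} {b} }
      ; comm = λ a b → ≈from≡ (ℤP.+-comm a b) }
    }

ℤ×ℤmod : ℕ → AbelianGroup 0ℓ 0ℓ
ℤ×ℤmod m = DP.abelianGroup ℤ-group (ℤmod m)

module Submission where

-- In Pic the first path v₀ ← v₁ ← ⋯ ← v_p and the second path v_{p+k} → ⋯ → v_{n-1} → v₀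
-- make every vertex off the bidirectional stretch equivalent to v₀ (the Laplacian row of v_a
-- there is e_a − e_{a∓1}). The rows of v_p, …, v_{p+k} read 2e_a = e_{a-1} + e_{a+1}, so the
-- classes of v_{p-1+m}, 0 ≤ m ≤ k + 1, form an arithmetic progression e₀ + m·d with
-- d = e_p − e₀; the row of the last vertex v_{p+k}, whose successor is again ≡ e₀, adds the
-- relation (k + 2)·d = 0. Hence Pic is generated by e₀ and d subject only to (k + 2)·d = 0.
-- Dually, the degree and the weight c with c(v_{p-1+m}) = m on the stretch and 0 elsewhere
-- kill the rows (c modulo k + 2), take the values (1, 0) and (0, 1) on e₀ and d, and give the
-- isomorphism; since the degree is torsion free, Jac is the kernel of the degree.

open import Defs
open import Data.Nat using (ℕ; _+_; _≤_)
open import Data.Nat as ℕ using (zero; suc; _<_; _≡ᵇ_; _<ᵇ_; _≤ᵇ_; _∸_; z≤n; s≤s; z<s; NonZero)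
import Data.Nat.Properties as ℕP
open import Data.Bool using (Bool; true; false; _∧_; _∨_; if_then_else_)
import Data.Bool.Properties as BP
open import Data.Fin using (Fin; toℕ; fromℕ<) renaming (zero to fz; suc to fs)
open import Data.Fin.Properties using (toℕ<n; toℕ-fromℕ<)
open import Data.Integer using (ℤ; +_; -_) renaming (_+_ to _+ᶻ_; _-_ to _-ᶻ_; _*_ to _*ᶻ_)
import Data.Integer.Properties as ℤP
open import Data.Integer.Divisibility.Signed
  using (_∣_; divides; ∣-refl; 0∣⇒≡0; ∣m∣n⇒∣m+n; ∣n⇒∣m*n; ∣m⇒∣m*n)
open import Data.Integer.Tactic.RingSolver using (solve-∀)
open import Data.Product using (_×_; Σ; _,_; proj₁; proj₂)
open import Data.Sum using (inj₁; inj₂)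
open import Data.Empty using (⊥-elim)
open import Algebra.Bundles using (AbelianGroup)
open import Algebra.Properties.Semiring.Sum ℤP.+-*-semiring
  using (sum; sum-cong-≗; ∑-distrib-+; ∑-comm; *-distribˡ-sum; *-distribʳ-sum; sum-replicate-zero)
open import Function.Bundles using (_⇔_; mk⇔; Equivalence)
open import Relation.Binary.Bundles using (Setoid)
import Relation.Binary.Reasoning.Setoid
open import Relation.Binary.PropositionalEquality
open import Relation.Nullary using (yes; no; ¬_)
open import Relation.Nullary.Decidable using (dec-true; dec-false)

infixl 6 _⊖_

_⊖_ : ∀ {n} → Vecℤ n → Vecℤ n → Vecℤ n
(x ⊖ y) i = x i -ᶻ y i

0ᵥ : ∀ {n} → Vecℤ n
0ᵥ _ = + 0

-- e_a, and 0ᵥ when a ≥ n.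
δ : ∀ {n} → ℕ → Vecℤ n
δ a j = + bit (a ≡ᵇ toℕ j)

≡ᵇ-sym : ∀ a b → (a ≡ᵇ b) ≡ (b ≡ᵇ a)
≡ᵇ-sym zero    zero    = refl
≡ᵇ-sym zero    (suc b) = refl
≡ᵇ-sym (suc a) zero    = refl
≡ᵇ-sym (suc a) (suc b) = ≡ᵇ-sym a b

≡ᵇ-true⇒≡ : ∀ {a b} → (a ≡ᵇ b) ≡ true → a ≡ b
≡ᵇ-true⇒≡ {a} {b} e = ℕP.≡ᵇ⇒≡ a b (Equivalence.from BP.T-≡ e)

≡ᵇ-false : ∀ {a b} → ¬ a ≡ b → (a ≡ᵇ b) ≡ false
≡ᵇ-false {a} {b} = dec-false (a ℕ.≟ b)

δ-sym : ∀ {n} (i j : Fin n) → δ (toℕ i) j ≡ δ (toℕ j) i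
δ-sym i j = cong (λ b → + bit b) (≡ᵇ-sym (toℕ i) (toℕ j))

sumℤ≡sum : ∀ {n} (f : Vecℤ n) → sumℤ f ≡ sum f
sumℤ≡sum {zero}  f = refl
sumℤ≡sum {suc n} f = cong (f fz +ᶻ_) (sumℤ≡sum (λ i → f (fs i)))

sum-zero : ∀ {n} (f : Vecℤ n) → (∀ i → f i ≡ + 0) → sum f ≡ + 0
sum-zero {n} f f≗0 = trans (sum-cong-≗ {x = f} f≗0) (sum-replicate-zero n)

sum-*δ : ∀ {n} (f : Vecℤ n) (i : Fin n) → sum (λ j → f j *ᶻ δ (toℕ i) j) ≡ f i
sum-*δ f fz = begin
  f fz *ᶻ + 1 +ᶻ sum (λ j → f (fs j) *ᶻ + 0)
    ≡⟨ cong₂ _+ᶻ_ (ℤP.*-identityʳ (f fz))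
                  (sum-zero (λ j → f (fs j) *ᶻ + 0) (λ j → ℤP.*-zeroʳ (f (fs j)))) ⟩
  f fz +ᶻ + 0
    ≡⟨ ℤP.+-identityʳ (f fz) ⟩
  f fz ∎
  where open ≡-Reasoning
sum-*δ f (fs i) = begin
  f fz *ᶻ + 0 +ᶻ rest   ≡⟨ cong (_+ᶻ rest) (ℤP.*-zeroʳ (f fz)) ⟩
  + 0 +ᶻ rest           ≡⟨ ℤP.+-identityˡ rest ⟩
  rest                  ≡⟨ sum-*δ (λ j → f (fs j)) i ⟩
  f (fs i)              ∎
  where
  open ≡-Reasoning
  rest = sum (λ j → f (fs j) *ᶻ δ (toℕ i) j)

∣0 : ∀ {m} → m ∣ + 0
∣0 {m} = divides (+ 0) (sym (ℤP.*-zeroˡ m))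

∣-sum : ∀ {n} {m : ℤ} (f : Vecℤ n) → (∀ i → m ∣ f i) → m ∣ sum f
∣-sum {zero}  f m∣f = ∣0
∣-sum {suc n} f m∣f = ∣m∣n⇒∣m+n (m∣f fz) (∣-sum (λ i → f (fs i)) (λ i → m∣f (fs i)))

vsum : ∀ {m n} → (Fin m → Vecℤ n) → Vecℤ n
vsum F j = sum (λ v → F v j)

vsum-δ : ∀ {n} (x : Vecℤ n) → x ≗ vsum (λ v → scale (x v) (δ (toℕ v)))
vsum-δ x j = sym (trans (sum-cong-≗ (λ v → cong (x v *ᶻ_) (δ-sym v j))) (sum-*δ x j))

⟨_,_⟩ : ∀ {n} → (ℕ → ℤ) → Vecℤ n → ℤ
⟨ w , x ⟩ = sum (λ j → w (toℕ j) *ᶻ x j)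

⟨⟩-⊕ : ∀ {n} w (x y : Vecℤ n) → ⟨ w , x ⊕ y ⟩ ≡ ⟨ w , x ⟩ +ᶻ ⟨ w , y ⟩
⟨⟩-⊕ w x y = trans (sum-cong-≗ (λ j → ℤP.*-distribˡ-+ (w (toℕ j)) (x j) (y j)))
                   (∑-distrib-+ (λ j → w (toℕ j) *ᶻ x j) (λ j → w (toℕ j) *ᶻ y j))

⟨⟩-scale : ∀ {n} w c (x : Vecℤ n) → ⟨ w , scale c x ⟩ ≡ c *ᶻ ⟨ w , x ⟩
⟨⟩-scale w c x = trans (sum-cong-≗ (λ j → swap (w (toℕ j)) c (x j)))
                       (sym (*-distribˡ-sum c (λ j → w (toℕ j) *ᶻ x j)))
  where
  swap : ∀ a b c → a *ᶻ (b *ᶻ c) ≡ b *ᶻ (a *ᶻ c)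
  swap = solve-∀

⟨⟩-⊖ : ∀ {n} w (x y : Vecℤ n) → ⟨ w , x ⊖ y ⟩ ≡ ⟨ w , x ⟩ -ᶻ ⟨ w , y ⟩
⟨⟩-⊖ w x y = begin
  ⟨ w , x ⊖ y ⟩                         ≡⟨ sum-cong-≗ (λ j → cong (w (toℕ j) *ᶻ_) (minus (x j) (y j))) ⟩
  ⟨ w , x ⊕ scale (- + 1) y ⟩           ≡⟨ ⟨⟩-⊕ w x (scale (- + 1) y) ⟩
  ⟨ w , x ⟩ +ᶻ ⟨ w , scale (- + 1) y ⟩  ≡⟨ cong (⟨ w , x ⟩ +ᶻ_) (⟨⟩-scale w (- + 1) y) ⟩
  ⟨ w , x ⟩ +ᶻ - + 1 *ᶻ ⟨ w , y ⟩       ≡⟨ sym (minus ⟨ w , x ⟩ ⟨ w , y ⟩) ⟩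
  ⟨ w , x ⟩ -ᶻ ⟨ w , y ⟩                ∎
  where
  open ≡-Reasoning
  minus : ∀ a b → a -ᶻ b ≡ a +ᶻ - + 1 *ᶻ b
  minus = solve-∀

⟨⟩-δ : ∀ {n} w {a} → a < n → ⟨ w , δ {n} a ⟩ ≡ w a
⟨⟩-δ {n} w {a} a<n =
  subst (λ b → ⟨ w , δ {n} b ⟩ ≡ w b) (toℕ-fromℕ< a<n) (sum-*δ (λ j → w (toℕ j)) (fromℕ< a<n))

module LinearEquivalence {n} (L : Fin n → Fin n → ℤ) where

  Lᵀ : Vecℤ n → Vecℤ n
  Lᵀ y j = sum (λ i → L i j *ᶻ y i)

  Im : Vecℤ n → Set
  Im = InImageLT L

  Im-Lᵀ : ∀ y → Im (Lᵀ y)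
  Im-Lᵀ y = y , λ j → sym (sumℤ≡sum (λ i → L i j *ᶻ y i))

  Im⇒Lᵀ : ∀ {x} → Im x → Σ (Vecℤ n) λ y → x ≗ Lᵀ y
  Im⇒Lᵀ (y , x≡) = y , λ j → trans (x≡ j) (sumℤ≡sum (λ i → L i j *ᶻ y i))

  Im-resp : ∀ {x x′} → x ≗ x′ → Im x → Im x′
  Im-resp x≗x′ (y , x≡) = y , λ j → trans (sym (x≗x′ j)) (x≡ j)

  Im-row : ∀ i → Im (L i)
  Im-row i = Im-resp (λ j → sum-*δ (λ i′ → L i′ j) i) (Im-Lᵀ (δ (toℕ i)))

  Im-0 : Im 0ᵥ
  Im-0 = Im-resp (λ j → sum-zero (λ i → L i j *ᶻ + 0) (λ i → ℤP.*-zeroʳ (L i j))) (Im-Lᵀ 0ᵥ)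

  Im-⊕ : ∀ {x x′} → Im x → Im x′ → Im (x ⊕ x′)
  Im-⊕ {x} {x′} X X′ with Im⇒Lᵀ X | Im⇒Lᵀ X′
  ... | y , x≗ | y′ , x′≗ = Im-resp Lᵀ-⊕ (Im-Lᵀ (y ⊕ y′))
    where
    Lᵀ-⊕ : Lᵀ (y ⊕ y′) ≗ x ⊕ x′
    Lᵀ-⊕ j = trans (sum-cong-≗ (λ i → ℤP.*-distribˡ-+ (L i j) (y i) (y′ i)))
                   (trans (∑-distrib-+ (λ i → L i j *ᶻ y i) (λ i → L i j *ᶻ y′ i))
                          (sym (cong₂ _+ᶻ_ (x≗ j) (x′≗ j))))

  Im-scale : ∀ c {x} → Im x → Im (scale c x)
  Im-scale c {x} X with Im⇒Lᵀ X
  ... | y , x≗ = Im-resp Lᵀ-scale (Im-Lᵀ (scale c y))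
    where
    swap : ∀ a b c → a *ᶻ (b *ᶻ c) ≡ b *ᶻ (a *ᶻ c)
    swap = solve-∀
    Lᵀ-scale : Lᵀ (scale c y) ≗ scale c x
    Lᵀ-scale j = trans (sum-cong-≗ (λ i → swap (L i j) c (y i)))
                       (trans (sym (*-distribˡ-sum c (λ i → L i j *ᶻ y i))) (sym (cong (c *ᶻ_) (x≗ j))))

  ⟨⟩-Lᵀ : ∀ w y → ⟨ w , Lᵀ y ⟩ ≡ sum (λ i → y i *ᶻ ⟨ w , L i ⟩)
  ⟨⟩-Lᵀ w y = begin
    sum (λ j → w (toℕ j) *ᶻ sum (λ i → L i j *ᶻ y i))
      ≡⟨ sum-cong-≗ (λ j → *-distribˡ-sum (w (toℕ j)) (λ i → L i j *ᶻ y i)) ⟩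
    sum (λ j → sum (λ i → w (toℕ j) *ᶻ (L i j *ᶻ y i)))
      ≡⟨ ∑-comm (λ j i → w (toℕ j) *ᶻ (L i j *ᶻ y i)) ⟩
    sum (λ i → sum (λ j → w (toℕ j) *ᶻ (L i j *ᶻ y i)))
      ≡⟨ sum-cong-≗ (λ i → sum-cong-≗ (λ j → rearrange (w (toℕ j)) (L i j) (y i))) ⟩
    sum (λ i → sum (λ j → y i *ᶻ (w (toℕ j) *ᶻ L i j)))
      ≡⟨ sum-cong-≗ (λ i → sym (*-distribˡ-sum (y i) (λ j → w (toℕ j) *ᶻ L i j))) ⟩
    sum (λ i → y i *ᶻ ⟨ w , L i ⟩) ∎
    where
    open ≡-Reasoning
    rearrange : ∀ a b c → a *ᶻ (b *ᶻ c) ≡ c *ᶻ (a *ᶻ b)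
    rearrange = solve-∀

  ∣⟨⟩-Im : ∀ {m w x} → (∀ i → m ∣ ⟨ w , L i ⟩) → Im x → m ∣ ⟨ w , x ⟩
  ∣⟨⟩-Im {m} {w} m∣row X with Im⇒Lᵀ X
  ... | y , x≗ = subst (m ∣_) (sym (trans (sum-cong-≗ (λ j → cong (w (toℕ j) *ᶻ_) (x≗ j))) (⟨⟩-Lᵀ w y)))
                       (∣-sum (λ i → y i *ᶻ ⟨ w , L i ⟩) (λ i → ∣n⇒∣m*n (y i) (m∣row i)))

  infix 4 _≋_

  -- Equality in Pic = ℤⁿ / Lᵀℤⁿ. A record rather than a synonym for Im (x ⊖ y), so that
  -- x and y can be inferred from a proof.
  record _≋_ (x y : Vecℤ n) : Set where
    constructor by-Im
    field Im-⊖ : Im (x ⊖ y)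

  ≗⇒≋ : ∀ {x y} → x ≗ y → x ≋ y
  ≗⇒≋ {x} {y} x≗y = by-Im (Im-resp (λ j → sym (trans (cong (_-ᶻ y j) (x≗y j)) (ℤP.+-inverseʳ (y j)))) Im-0)

  ≋-refl : ∀ {x} → x ≋ x
  ≋-refl = ≗⇒≋ (λ _ → refl)

  ≋-sym : ∀ {x y} → x ≋ y → y ≋ x
  ≋-sym {x} {y} (by-Im x-y) = by-Im (Im-resp (λ j → negate (x j) (y j)) (Im-scale (- + 1) x-y))
    where
    negate : ∀ a b → - + 1 *ᶻ (a -ᶻ b) ≡ b -ᶻ a
    negate = solve-∀

  ≋-trans : ∀ {x y z} → x ≋ y → y ≋ z → x ≋ z
  ≋-trans {x} {y} {z} (by-Im x-y) (by-Im y-z) =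
    by-Im (Im-resp (λ j → telescope (x j) (y j) (z j)) (Im-⊕ x-y y-z))
    where
    telescope : ∀ a b c → (a -ᶻ b) +ᶻ (b -ᶻ c) ≡ a -ᶻ c
    telescope = solve-∀

  ≋-setoid : Setoid _ _
  ≋-setoid = record
    { Carrier = Vecℤ n ; _≈_ = _≋_
    ; isEquivalence = record { refl = ≋-refl ; sym = ≋-sym ; trans = ≋-trans } }

  module ≋-Reasoning = Relation.Binary.Reasoning.Setoid ≋-setoid

  Im⇒≋0 : ∀ {x} → Im x → x ≋ 0ᵥ
  Im⇒≋0 {x} X = by-Im (Im-resp (λ j → sym (ℤP.+-identityʳ (x j))) X)

  ≋0⇒Im : ∀ {x} → x ≋ 0ᵥ → Im x
  ≋0⇒Im {x} (by-Im X) = Im-resp (λ j → ℤP.+-identityʳ (x j)) X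

  ⊕-cong : ∀ {x x′ y y′} → x ≋ x′ → y ≋ y′ → x ⊕ y ≋ x′ ⊕ y′
  ⊕-cong {x} {x′} {y} {y′} (by-Im x-x′) (by-Im y-y′) =
    by-Im (Im-resp (λ j → interchange (x j) (x′ j) (y j) (y′ j)) (Im-⊕ x-x′ y-y′))
    where
    interchange : ∀ a a′ b b′ → (a -ᶻ a′) +ᶻ (b -ᶻ b′) ≡ (a +ᶻ b) -ᶻ (a′ +ᶻ b′)
    interchange = solve-∀

  scale-cong : ∀ c {x y} → x ≋ y → scale c x ≋ scale c y
  scale-cong c {x} {y} (by-Im x-y) = by-Im (Im-resp (λ j → distrib c (x j) (y j)) (Im-scale c x-y))
    where
    distrib : ∀ c a b → c *ᶻ (a -ᶻ b) ≡ c *ᶻ a -ᶻ c *ᶻ b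
    distrib = solve-∀

  vsum-cong : ∀ {m} {F G : Fin m → Vecℤ n} → (∀ v → F v ≋ G v) → vsum F ≋ vsum G
  vsum-cong {zero}  F≋G = ≋-refl
  vsum-cong {suc m} F≋G = ⊕-cong (F≋G fz) (vsum-cong (λ v → F≋G (fs v)))

  ⊕-cancelˡ : ∀ {x y z} → x ⊕ y ≋ x ⊕ z → y ≋ z
  ⊕-cancelˡ {x} {y} {z} (by-Im X) = by-Im (Im-resp (λ j → cancel (x j) (y j) (z j)) X)
    where
    cancel : ∀ a b c → (a +ᶻ b) -ᶻ (a +ᶻ c) ≡ b -ᶻ c
    cancel = solve-∀

  extrapolate : ∀ {x y z P d} c → x ≋ P ⊕ scale c d → y ≋ P ⊕ scale (+ 1 +ᶻ c) d →
                y ⊕ y ≋ z ⊕ x → z ≋ P ⊕ scale (+ 2 +ᶻ c) d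
  extrapolate {x} {y} {z} {P} {d} c (by-Im X) (by-Im Y) (by-Im R) =
    by-Im (Im-resp (λ j → combine (x j) (y j) (z j) (P j) (d j) c)
                   (Im-⊕ (Im-⊕ (Im-scale (+ 2) Y) (Im-scale (- + 1) X)) (Im-scale (- + 1) R)))
    where
    combine : ∀ x y z P d c →
      + 2 *ᶻ (y -ᶻ (P +ᶻ (+ 1 +ᶻ c) *ᶻ d)) +ᶻ - + 1 *ᶻ (x -ᶻ (P +ᶻ c *ᶻ d))
        +ᶻ - + 1 *ᶻ ((y +ᶻ y) -ᶻ (z +ᶻ x))
      ≡ z -ᶻ (P +ᶻ (+ 2 +ᶻ c) *ᶻ d)
    combine = solve-∀

  -- Pic ≅ ℤ × ℤ_K as soon as two weights, one vanishing and one divisible by K on every row,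
  -- are dual to a pair u, d that spans ℤⁿ modulo the image and satisfies K·d ≋ 0.
  module Presentation
    (K : ℕ) (w₁ w₂ : ℕ → ℤ) (u d : Vecℤ n)
    (w₁-row : ∀ i → ⟨ w₁ , L i ⟩ ≡ + 0) (w₂-row : ∀ i → + K ∣ ⟨ w₂ , L i ⟩)
    (w₁-u : ⟨ w₁ , u ⟩ ≡ + 1) (w₂-u : ⟨ w₂ , u ⟩ ≡ + 0)
    (w₁-d : ⟨ w₁ , d ⟩ ≡ + 0) (w₂-d : ⟨ w₂ , d ⟩ ≡ + 1)
    (K·d≋0 : scale (+ K) d ≋ 0ᵥ)
    (δ≋ : ∀ (v : Fin n) → δ (toℕ v) ≋ scale (w₁ (toℕ v)) u ⊕ scale (w₂ (toℕ v)) d)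
    where

    section : ℤ → ℤ → Vecℤ n
    section h₁ h₂ = scale h₁ u ⊕ scale h₂ d

    ⟨⟩-section : ∀ w h₁ h₂ {c₁ c₂} → ⟨ w , u ⟩ ≡ c₁ → ⟨ w , d ⟩ ≡ c₂ →
                 ⟨ w , section h₁ h₂ ⟩ ≡ h₁ *ᶻ c₁ +ᶻ h₂ *ᶻ c₂
    ⟨⟩-section w h₁ h₂ {c₁} {c₂} w-u w-d = begin
      ⟨ w , section h₁ h₂ ⟩                    ≡⟨ ⟨⟩-⊕ w (scale h₁ u) (scale h₂ d) ⟩
      ⟨ w , scale h₁ u ⟩ +ᶻ ⟨ w , scale h₂ d ⟩  ≡⟨ cong₂ _+ᶻ_ (⟨⟩-scale w h₁ u) (⟨⟩-scale w h₂ d) ⟩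
      h₁ *ᶻ ⟨ w , u ⟩ +ᶻ h₂ *ᶻ ⟨ w , d ⟩        ≡⟨ cong₂ (λ a b → h₁ *ᶻ a +ᶻ h₂ *ᶻ b) w-u w-d ⟩
      h₁ *ᶻ c₁ +ᶻ h₂ *ᶻ c₂                      ∎
      where open ≡-Reasoning

    ⟨w₁⟩-section : ∀ h₁ h₂ → ⟨ w₁ , section h₁ h₂ ⟩ ≡ h₁
    ⟨w₁⟩-section h₁ h₂ = trans (⟨⟩-section w₁ h₁ h₂ w₁-u w₁-d) (first h₁ h₂)
      where
      first : ∀ a b → a *ᶻ + 1 +ᶻ b *ᶻ + 0 ≡ a
      first = solve-∀

    ⟨w₂⟩-section : ∀ h₁ h₂ → ⟨ w₂ , section h₁ h₂ ⟩ ≡ h₂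
    ⟨w₂⟩-section h₁ h₂ = trans (⟨⟩-section w₂ h₁ h₂ w₂-u w₂-d) (second h₁ h₂)
      where
      second : ∀ a b → a *ᶻ + 0 +ᶻ b *ᶻ + 1 ≡ b
      second = solve-∀

    normal-form : ∀ x → x ≋ section ⟨ w₁ , x ⟩ ⟨ w₂ , x ⟩
    normal-form x = begin
      x                                    ≈⟨ ≗⇒≋ (vsum-δ x) ⟩
      vsum (λ v → scale (x v) (δ (toℕ v))) ≈⟨ vsum-cong (λ v → scale-cong (x v) (δ≋ v)) ⟩
      vsum (λ v → scale (x v) (section (w₁ (toℕ v)) (w₂ (toℕ v))))
                                           ≈⟨ ≗⇒≋ collect ⟩
      section ⟨ w₁ , x ⟩ ⟨ w₂ , x ⟩        ∎
      where
      open ≋-Reasoning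
      expand : ∀ a b₁ b₂ c₁ c₂ →
               a *ᶻ (b₁ *ᶻ c₁ +ᶻ b₂ *ᶻ c₂) ≡ (b₁ *ᶻ a) *ᶻ c₁ +ᶻ (b₂ *ᶻ a) *ᶻ c₂
      expand = solve-∀
      collect : vsum (λ v → scale (x v) (section (w₁ (toℕ v)) (w₂ (toℕ v))))
                ≗ section ⟨ w₁ , x ⟩ ⟨ w₂ , x ⟩
      collect j =
        trans (sum-cong-≗ (λ v → expand (x v) (w₁ (toℕ v)) (w₂ (toℕ v)) (u j) (d j)))
        (trans (∑-distrib-+ (λ v → w₁ (toℕ v) *ᶻ x v *ᶻ u j) (λ v → w₂ (toℕ v) *ᶻ x v *ᶻ d j))
               (sym (cong₂ _+ᶻ_ (*-distribʳ-sum (u j) (λ v → w₁ (toℕ v) *ᶻ x v))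
                                (*-distribʳ-sum (d j) (λ v → w₂ (toℕ v) *ᶻ x v)))))

    -- The degree case is the divisibility statement for m = 0, as 0 ∣ z only for z = 0.
    ⟨w₁⟩-Im : ∀ {x} → Im x → ⟨ w₁ , x ⟩ ≡ + 0
    ⟨w₁⟩-Im X = 0∣⇒≡0 (∣⟨⟩-Im {w = w₁} (λ i → subst (+ 0 ∣_) (sym (w₁-row i)) ∣-refl) X)

    ⟨w₂⟩-Im : ∀ {x} → Im x → + K ∣ ⟨ w₂ , x ⟩
    ⟨w₂⟩-Im = ∣⟨⟩-Im {w = w₂} w₂-row

    Im-section : ∀ h₁ h₂ → h₁ ≡ + 0 → + K ∣ h₂ → Im (section h₁ h₂)
    Im-section h₁ h₂ h₁≡0 (divides t h₂≡t*K) = ≋0⇒Im (begin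
      section h₁ h₂            ≈⟨ ≗⇒≋ (λ j → multiple (u j) (d j) h₁≡0 h₂≡t*K) ⟩
      scale t (scale (+ K) d)  ≈⟨ scale-cong t K·d≋0 ⟩
      scale t 0ᵥ               ≈⟨ ≗⇒≋ (λ _ → ℤP.*-zeroʳ t) ⟩
      0ᵥ                       ∎)
      where
      open ≋-Reasoning
      ring : ∀ a b t k → + 0 *ᶻ a +ᶻ (t *ᶻ k) *ᶻ b ≡ t *ᶻ (k *ᶻ b)
      ring = solve-∀
      multiple : ∀ a b → h₁ ≡ + 0 → h₂ ≡ t *ᶻ + K → h₁ *ᶻ a +ᶻ h₂ *ᶻ b ≡ t *ᶻ (+ K *ᶻ b)
      multiple a b refl refl = ring a b t (+ K)

    Im⇔ : ∀ x → Im x ⇔ (⟨ w₁ , x ⟩ ≡ + 0 × + K ∣ ⟨ w₂ , x ⟩)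
    Im⇔ x = mk⇔ (λ X → ⟨w₁⟩-Im X , ⟨w₂⟩-Im X)
                (λ (w₁x≡0 , K∣w₂x) → ≋0⇒Im (≋-trans (normal-form x)
                   (Im⇒≋0 (Im-section ⟨ w₁ , x ⟩ ⟨ w₂ , x ⟩ w₁x≡0 K∣w₂x))))

    ⟨w₁⟩-torsion : ∀ {x} c → Im (scale (+ suc c) x) → ⟨ w₁ , x ⟩ ≡ + 0
    ⟨w₁⟩-torsion {x} c X = ℤP.*-cancelˡ-≡ (+ suc c) ⟨ w₁ , x ⟩ (+ 0)
      (trans (sym (⟨⟩-scale w₁ (+ suc c) x)) (trans (⟨w₁⟩-Im X) (sym (ℤP.*-zeroʳ (+ suc c)))))

    open AbelianGroup (ℤmod K) using () renaming (_≈_ to _≈ₖ_; reflexive to ≡⇒≈ₖ)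

    ≈ₖ0⇔ : ∀ {z} → z ≈ₖ + 0 ⇔ + K ∣ z
    ≈ₖ0⇔ {z} = mk⇔ (subst (+ K ∣_) (ℤP.+-identityʳ z)) (subst (+ K ∣_) (sym (ℤP.+-identityʳ z)))

    picIso : PicIso n L (ℤ×ℤmod K)
    picIso = record
      { φ          = λ x → ⟨ w₁ , x ⟩ , ⟨ w₂ , x ⟩
      ; hom        = λ x y → ⟨⟩-⊕ w₁ x y , ≡⇒≈ₖ (⟨⟩-⊕ w₂ x y)
      ; surjective = λ (h₁ , h₂) →
          section h₁ h₂ , ⟨w₁⟩-section h₁ h₂ , ≡⇒≈ₖ (⟨w₂⟩-section h₁ h₂)
      ; kernel     = λ x → mk⇔
          (λ (w₁x≡0 , w₂x≈0) → Equivalence.from (Im⇔ x) (w₁x≡0 , Equivalence.to ≈ₖ0⇔ w₂x≈0))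
          (λ X → ⟨w₁⟩-Im X , Equivalence.from ≈ₖ0⇔ (⟨w₂⟩-Im X))
      }

    jacIso : .{{NonZero K}} → JacIso n L (ℤmod K)
    jacIso = record
      { φ          = λ x _ → ⟨ w₂ , x ⟩
      ; irrelevant = λ x _ _ → ≡⇒≈ₖ {⟨ w₂ , x ⟩} refl
      ; hom        = λ x y _ _ _ → ≡⇒≈ₖ (⟨⟩-⊕ w₂ x y)
      ; surjective = λ h → section (+ 0) h , (ℕ.pred K , torsion h) , ≡⇒≈ₖ (⟨w₂⟩-section (+ 0) h)
      ; kernel     = λ x (c , X) → mk⇔
          (λ w₂x≈0 → Equivalence.from (Im⇔ x) (⟨w₁⟩-torsion c X , Equivalence.to ≈ₖ0⇔ w₂x≈0))
          (λ X → Equivalence.from ≈ₖ0⇔ (⟨w₂⟩-Im X))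
      }
      where
      distrib : ∀ k h a b → k *ᶻ (+ 0 *ᶻ a +ᶻ h *ᶻ b) ≡ (k *ᶻ + 0) *ᶻ a +ᶻ (k *ᶻ h) *ᶻ b
      distrib = solve-∀
      torsion : ∀ h → Im (scale (+ suc (ℕ.pred K)) (section (+ 0) h))
      torsion h = subst (λ k → Im (scale (+ k) (section (+ 0) h))) (sym (ℕP.suc-pred K))
        (Im-resp (λ j → sym (distrib (+ K) h (u j) (d j)))
                 (Im-section (+ K *ᶻ + 0) (+ K *ᶻ h) (ℤP.*-zeroʳ (+ K)) (∣m⇒∣m*n h ∣-refl)))

bit-≡ᵇ-∧ : ∀ c b (P : ℕ → Bool) → + bit ((c ≡ᵇ b) ∧ P b) ≡ + bit (P c) *ᶻ + bit (c ≡ᵇ b)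
bit-≡ᵇ-∧ c b P with c ≡ᵇ b in e
... | true  = trans (cong (λ x → + bit (P x)) (sym (≡ᵇ-true⇒≡ e))) (sym (ℤP.*-identityʳ (+ bit (P c))))
... | false = sym (ℤP.*-zeroʳ (+ bit (P c)))

next : ℕ → ℕ → ℕ
next n a = if suc a ≡ᵇ n then 0 else suc a

prev : ℕ → ℕ → ℕ
prev n zero    = n ∸ 1
prev n (suc a) = a

next-last : ∀ {n a} → suc a ≡ n → next n a ≡ 0
next-last {n} {a} e = cong (λ b → if b then 0 else suc a) (dec-true (suc a ℕ.≟ n) e)

next-inner : ∀ {n a} → suc a < n → next n a ≡ suc a
next-inner {n} {a} lt = cong (λ b → if b then 0 else suc a) (dec-false (suc a ℕ.≟ n) (ℕP.<⇒≢ lt))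

next<n : ∀ {n a} → a < n → next n a < n
next<n {n} {a} a<n with suc a ℕ.≟ n
... | yes sa≡n = subst (_< n) (sym (next-last sa≡n)) (ℕP.≤-<-trans z≤n a<n)
... | no  sa≢n = subst (_< n) (sym (next-inner sa<n)) sa<n
  where
  sa<n : suc a < n
  sa<n = ℕP.≤∧≢⇒< a<n sa≢n

prev<n : ∀ {n a} → a < n → prev n a < n
prev<n {suc n} {zero}    _   = ℕP.n<1+n n
prev<n         {a = suc a} a<n = ℕP.<-trans (ℕP.n<1+n a) a<n

-- h a is the arrow between v_a and v_{a+1}; every directed cycle graph, and twoOpposite
-- literally, is of this form.
module DirectedCycle {n} (2≤n : 2 ≤ n) (h : ℕ → Arrow) where

  G : DirCycle n
  G e = h (toℕ e)

  isNext≡next : ∀ (i j : Fin n) → isNext i j ≡ (next n (toℕ i) ≡ᵇ toℕ j)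
  isNext≡next i j = go (toℕ i) (toℕ j) (toℕ<n j)
    where
    go : ∀ a b → b < n → ((suc a ≡ᵇ b) ∨ ((suc a ≡ᵇ n) ∧ (b ≡ᵇ 0))) ≡ (next n a ≡ᵇ b)
    go a b b<n with suc a ≡ᵇ n in e
    ... | false = BP.∨-identityʳ (suc a ≡ᵇ b)
    ... | true  = trans (cong (_∨ (b ≡ᵇ 0)) (≡ᵇ-false {suc a} {b} sa≢b)) (≡ᵇ-sym b 0)
      where
      sa≢b : ¬ suc a ≡ b
      sa≢b refl = ℕP.<-irrefl (≡ᵇ-true⇒≡ e) b<n

  isNext≡prev : ∀ (i j : Fin n) → isNext j i ≡ (prev n (toℕ i) ≡ᵇ toℕ j)
  isNext≡prev i j = go (toℕ i) (toℕ j)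
    where
    pred-≡ᵇ : ∀ m b → 1 ≤ m → (suc b ≡ᵇ m) ≡ (m ∸ 1 ≡ᵇ b)
    pred-≡ᵇ (suc m) b _ = ≡ᵇ-sym b m
    go : ∀ a b → ((suc b ≡ᵇ a) ∨ ((suc b ≡ᵇ n) ∧ (a ≡ᵇ 0))) ≡ (prev n a ≡ᵇ b)
    go zero    b = trans (BP.∧-identityʳ (suc b ≡ᵇ n)) (pred-≡ᵇ n b (ℕP.≤-trans (s≤s z≤n) 2≤n))
    go (suc a) b = trans (cong ((b ≡ᵇ a) ∨_) (BP.∧-zeroʳ (suc b ≡ᵇ n)))
                         (trans (BP.∨-identityʳ (b ≡ᵇ a)) (≡ᵇ-sym b a))

  toNext toPrev : ℕ → ℤ
  toNext a = + bit (goesFwd (h a))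
  toPrev a = + bit (goesBwd (h (prev n a)))

  arrows≡ : ∀ i j → let a = toℕ i in
            + arrows G i j ≡ toNext a *ᶻ δ (next n a) j +ᶻ toPrev a *ᶻ δ (prev n a) j
  arrows≡ i j = begin
    + (bit (isNext i j ∧ goesFwd (h a)) + bit (isNext j i ∧ goesBwd (h b)))
      ≡⟨ ℤP.pos-+ (bit (isNext i j ∧ goesFwd (h a))) (bit (isNext j i ∧ goesBwd (h b))) ⟩
    + bit (isNext i j ∧ goesFwd (h a)) +ᶻ + bit (isNext j i ∧ goesBwd (h b))
      ≡⟨ cong₂ (λ x y → + bit (x ∧ goesFwd (h a)) +ᶻ + bit (y ∧ goesBwd (h b)))
               (isNext≡next i j) (isNext≡prev i j) ⟩
    + bit ((next n a ≡ᵇ b) ∧ goesFwd (h a)) +ᶻ + bit ((prev n a ≡ᵇ b) ∧ goesBwd (h b))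
      ≡⟨ cong₂ _+ᶻ_ (bit-≡ᵇ-∧ (next n a) b (λ _ → goesFwd (h a)))
                    (bit-≡ᵇ-∧ (prev n a) b (λ c → goesBwd (h c))) ⟩
    toNext a *ᶻ δ (next n a) j +ᶻ toPrev a *ᶻ δ (prev n a) j ∎
    where
    open ≡-Reasoning
    a = toℕ i
    b = toℕ j

  outdeg≡ : ∀ i → outdeg G i ≡ toNext (toℕ i) +ᶻ toPrev (toℕ i)
  outdeg≡ i = begin
    sumℤ (λ j → + arrows G i j)
      ≡⟨ sumℤ≡sum (λ j → + arrows G i j) ⟩
    sum (λ j → + arrows G i j)
      ≡⟨ sum-cong-≗ (arrows≡ i) ⟩
    sum (λ j → F *ᶻ toS j +ᶻ B *ᶻ toR j)
      ≡⟨ ∑-distrib-+ (λ j → F *ᶻ toS j) (λ j → B *ᶻ toR j) ⟩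
    ⟨ (λ _ → F) , toS ⟩ +ᶻ ⟨ (λ _ → B) , toR ⟩
      ≡⟨ cong₂ _+ᶻ_ (⟨⟩-δ (λ _ → F) (next<n (toℕ<n i))) (⟨⟩-δ (λ _ → B) (prev<n (toℕ<n i))) ⟩
    F +ᶻ B ∎
    where
    open ≡-Reasoning
    a = toℕ i
    F = toNext a
    B = toPrev a
    toS toR : Vecℤ n
    toS = δ (next n a)
    toR = δ (prev n a)

  next≢ : ∀ a → (next n a ≡ᵇ a) ≡ false
  next≢ a with suc a ≡ᵇ n in e
  next≢ zero    | true  = ⊥-elim (ℕP.<-irrefl (≡ᵇ-true⇒≡ e) 2≤n)
  next≢ (suc a) | true  = refl
  next≢ a       | false = ≡ᵇ-false (λ eq → ℕP.<⇒≢ (ℕP.n<1+n a) (sym eq))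

  prev≢ : ∀ a → (prev n a ≡ᵇ a) ≡ false
  prev≢ zero    = ≡ᵇ-false (λ eq → ℕP.<⇒≢ (ℕP.∸-monoˡ-≤ 1 2≤n) (sym eq))
  prev≢ (suc a) = ≡ᵇ-false (ℕP.<⇒≢ (ℕP.n<1+n a))

  row : ℕ → Vecℤ n
  row a = scale (toNext a) (δ a ⊖ δ (next n a)) ⊕ scale (toPrev a) (δ a ⊖ δ (prev n a))

  laplacian-row : ∀ i → laplacian G i ≗ row (toℕ i)
  laplacian-row i j with toℕ i ℕ.≟ toℕ j
  ... | yes a≡b = trans (outdeg≡ i) (diagonal (toNext a) (toPrev a) δa≡1 δs≡0 δr≡0)
    where
    a = toℕ i
    δa≡1 : δ a j ≡ + 1
    δa≡1 = cong (λ x → + bit x) (dec-true (a ℕ.≟ toℕ j) a≡b)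
    δs≡0 : δ (next n a) j ≡ + 0
    δs≡0 = cong (λ x → + bit x) (trans (cong (next n a ≡ᵇ_) (sym a≡b)) (next≢ a))
    δr≡0 : δ (prev n a) j ≡ + 0
    δr≡0 = cong (λ x → + bit x) (trans (cong (prev n a ≡ᵇ_) (sym a≡b)) (prev≢ a))
    ring : ∀ F B → F +ᶻ B ≡ F *ᶻ (+ 1 -ᶻ + 0) +ᶻ B *ᶻ (+ 1 -ᶻ + 0)
    ring = solve-∀
    diagonal : ∀ F B {x s r} → x ≡ + 1 → s ≡ + 0 → r ≡ + 0 →
               F +ᶻ B ≡ F *ᶻ (x -ᶻ s) +ᶻ B *ᶻ (x -ᶻ r)
    diagonal F B refl refl refl = ring F B
  ... | no a≢b = trans (cong -_ (arrows≡ i j))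
                       (off-diagonal (toNext a) (toPrev a) (δ (next n a) j) (δ (prev n a) j) δa≡0)
    where
    a = toℕ i
    δa≡0 : δ a j ≡ + 0
    δa≡0 = cong (λ x → + bit x) (≡ᵇ-false a≢b)
    ring : ∀ F B s r → - (F *ᶻ s +ᶻ B *ᶻ r) ≡ F *ᶻ (+ 0 -ᶻ s) +ᶻ B *ᶻ (+ 0 -ᶻ r)
    ring = solve-∀
    off-diagonal : ∀ F B s r {x} → x ≡ + 0 → - (F *ᶻ s +ᶻ B *ᶻ r) ≡ F *ᶻ (x -ᶻ s) +ᶻ B *ᶻ (x -ᶻ r)
    off-diagonal F B s r refl = ring F B s r

  ⟨⟩-laplacian : ∀ w i → ⟨ w , laplacian G i ⟩ ≡ ⟨ w , row (toℕ i) ⟩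
  ⟨⟩-laplacian w i = sum-cong-≗ (λ j → cong (w (toℕ j) *ᶻ_) (laplacian-row i j))

  ⟨⟩-row : ∀ w {a} → a < n →
           ⟨ w , row a ⟩ ≡ toNext a *ᶻ (w a -ᶻ w (next n a)) +ᶻ toPrev a *ᶻ (w a -ᶻ w (prev n a))
  ⟨⟩-row w {a} a<n = begin
    ⟨ w , scale F toS ⊕ scale B toR ⟩           ≡⟨ ⟨⟩-⊕ w (scale F toS) (scale B toR) ⟩
    ⟨ w , scale F toS ⟩ +ᶻ ⟨ w , scale B toR ⟩  ≡⟨ cong₂ _+ᶻ_ (⟨⟩-scale w F toS) (⟨⟩-scale w B toR) ⟩
    F *ᶻ ⟨ w , toS ⟩ +ᶻ B *ᶻ ⟨ w , toR ⟩
      ≡⟨ cong₂ (λ x y → F *ᶻ x +ᶻ B *ᶻ y) (⟨δ⊖δ⟩ (next<n a<n)) (⟨δ⊖δ⟩ (prev<n a<n)) ⟩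
    F *ᶻ (w a -ᶻ w (next n a)) +ᶻ B *ᶻ (w a -ᶻ w (prev n a)) ∎
    where
    open ≡-Reasoning
    F = toNext a
    B = toPrev a
    toS toR : Vecℤ n
    toS = δ a ⊖ δ (next n a)
    toR = δ a ⊖ δ (prev n a)
    ⟨δ⊖δ⟩ : ∀ {b} → b < n → ⟨ w , δ {n} a ⊖ δ b ⟩ ≡ w a -ᶻ w b
    ⟨δ⊖δ⟩ {b} b<n = trans (⟨⟩-⊖ w (δ {n} a) (δ b)) (cong₂ _-ᶻ_ (⟨⟩-δ w a<n) (⟨⟩-δ w b<n))

count : ℕ → (ℕ → Bool) → ℕ
count zero    P = 0
count (suc m) P = bit (P 0) + count m (λ x → P (suc x))

numBi≡count : ∀ m (f : ℕ → Arrow) → numBi {m} (λ e → f (toℕ e)) ≡ count m (λ x → isBi (f x))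
numBi≡count zero    f = refl
numBi≡count (suc m) f = cong (λ z → bit (isBi (f 0)) + z) (numBi≡count m (λ x → f (suc x)))

count-+ : ∀ a b P → count (a + b) P ≡ count a P + count b (λ x → P (a + x))
count-+ zero    b P = refl
count-+ (suc a) b P = trans (cong (λ z → bit (P 0) + z) (count-+ a b (λ x → P (suc x))))
                            (sym (ℕP.+-assoc (bit (P 0)) (count a (λ x → P (suc x))) (count b (λ x → P (suc a + x)))))

count-none : ∀ m P → (∀ x → x < m → P x ≡ false) → count m P ≡ 0
count-none zero    P _    = refl
count-none (suc m) P none rewrite none 0 z<s =
  count-none m (λ x → P (suc x)) (λ x x<m → none (suc x) (s≤s x<m))

count-all : ∀ m P → (∀ x → x < m → P x ≡ true) → count m P ≡ m
count-all zero    P _   = refl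
count-all (suc m) P all rewrite all 0 z<s =
  cong suc (count-all m (λ x → P (suc x)) (λ x x<m → all (suc x) (s≤s x<m)))

module TwoOppositePaths (p′ k q′ : ℕ) where

  p q n K : ℕ
  p = suc p′
  q = suc q′
  n = p + k + q
  K = suc (suc k)

  h : ℕ → Arrow
  h a = if a <ᵇ p then bwd else (if n ∸ q ≤ᵇ a then fwd else bi)

  2≤n : 2 ≤ n
  2≤n = s≤s (ℕP.≤-trans (s≤s z≤n) (ℕP.m≤n+m q (p′ + k)))

  p+k<n : p + k < n
  p+k<n = ℕP.m<m+n (p + k) z<s

  p+k≤n∸1 : p + k ≤ n ∸ 1
  p+k≤n∸1 = subst (p + k ≤_) (sym (ℕP.+-suc (p′ + k) q′)) (s≤s (ℕP.m≤m+n (p′ + k) q′))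

  n∸q≡p+k : n ∸ q ≡ p + k
  n∸q≡p+k = ℕP.m+n∸n≡m (p + k) q

  <p⇒<p+k : ∀ {a} → a < p → a < p + k
  <p⇒<p+k a<p = ℕP.<-≤-trans a<p (ℕP.m≤m+n p k)

  ≤p+k⇒<n : ∀ {a} → a ≤ p + k → a < n
  ≤p+k⇒<n a≤p+k = ℕP.≤-<-trans a≤p+k p+k<n

  p<n : p < n
  p<n = ≤p+k⇒<n (ℕP.m≤m+n p k)

  stretch-bound : ∀ {m} → m ≤ k → suc m + p′ ≤ p + k
  stretch-bound {m} m≤k = s≤s (subst (m + p′ ≤_) (ℕP.+-comm k p′) (ℕP.+-monoˡ-≤ p′ m≤k))

  inner-bound : ∀ {m} → m < k → suc (m + p′) < p + k
  inner-bound = stretch-bound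

  top≤p+k : suc k + p′ ≤ p + k
  top≤p+k = stretch-bound ℕP.≤-refl

  top≥p+k : p + k ≤ suc k + p′
  top≥p+k = s≤s (ℕP.≤-reflexive (ℕP.+-comm p′ k))

  h-low : ∀ {a} → a < p → h a ≡ bwd
  h-low {a} a<p rewrite dec-true (a ℕ.<? p) a<p = refl

  h-high : ∀ {a} → p + k ≤ a → h a ≡ fwd
  h-high {a} p+k≤a
    rewrite dec-false (a ℕ.<? p) (ℕP.≤⇒≯ (ℕP.≤-trans (ℕP.m≤m+n p k) p+k≤a))
          | n∸q≡p+k | dec-true (p + k ℕ.≤? a) p+k≤a = refl

  h-middle : ∀ {a} → p ≤ a → a < p + k → h a ≡ bi
  h-middle {a} p≤a a<p+k
    rewrite dec-false (a ℕ.<? p) (ℕP.≤⇒≯ p≤a)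
          | n∸q≡p+k | dec-false (p + k ℕ.≤? a) (ℕP.<⇒≱ a<p+k) = refl

  goesFwd-from-p : ∀ {a} → p ≤ a → goesFwd (h a) ≡ true
  goesFwd-from-p {a} p≤a rewrite dec-false (a ℕ.<? p) (ℕP.≤⇒≯ p≤a) with n ∸ q ≤ᵇ a
  ... | true  = refl
  ... | false = refl

  goesBwd-below-p+k : ∀ {a} → a < p + k → goesBwd (h a) ≡ true
  goesBwd-below-p+k {a} a<p+k with a <ᵇ p
  ... | true  = refl
  ... | false rewrite n∸q≡p+k | dec-false (p + k ℕ.≤? a) (ℕP.<⇒≱ a<p+k) = refl

  open DirectedCycle 2≤n h
  open LinearEquivalence (laplacian G)

  toNext-low : ∀ {a} → a < p → toNext a ≡ + 0
  toNext-low a<p = cong (λ x → + bit (goesFwd x)) (h-low a<p)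

  toNext-from-p : ∀ {a} → p ≤ a → toNext a ≡ + 1
  toNext-from-p p≤a = cong (λ b → + bit b) (goesFwd-from-p p≤a)

  toPrev-zero : toPrev 0 ≡ + 0
  toPrev-zero = cong (λ x → + bit (goesBwd x)) (h-high p+k≤n∸1)

  toPrev-below-p+k : ∀ {a} → a < p + k → toPrev (suc a) ≡ + 1
  toPrev-below-p+k a<p+k = cong (λ b → + bit b) (goesBwd-below-p+k a<p+k)

  toPrev-from-p+k : ∀ {a} → p + k ≤ a → toPrev (suc a) ≡ + 0
  toPrev-from-p+k p+k≤a = cong (λ x → + bit (goesBwd x)) (h-high p+k≤a)

  Im-row-at : ∀ {a F B} → a < n → toNext a ≡ F → toPrev a ≡ B →
              Im (scale F (δ a ⊖ δ (next n a)) ⊕ scale B (δ a ⊖ δ (prev n a)))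
  Im-row-at {a} a<n refl refl = subst (λ b → Im (row b)) (toℕ-fromℕ< a<n)
    (Im-resp (laplacian-row (fromℕ< a<n)) (Im-row (fromℕ< a<n)))

  step-low : ∀ {a} → suc a < p → δ (suc a) ≋ δ a
  step-low {a} sa<p = by-Im (Im-resp (λ j → ring (δ (suc a) j) (δ (next n (suc a)) j) (δ a j))
    (Im-row-at (≤p+k⇒<n (ℕP.<⇒≤ (<p⇒<p+k sa<p))) (toNext-low sa<p)
               (toPrev-below-p+k (<p⇒<p+k (ℕP.<-trans (ℕP.n<1+n a) sa<p)))))
    where
    ring : ∀ x s r → + 0 *ᶻ (x -ᶻ s) +ᶻ + 1 *ᶻ (x -ᶻ r) ≡ x -ᶻ r
    ring = solve-∀

  step-middle : ∀ {a} → p ≤ suc a → suc a ≤ p + k →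
                δ (suc a) ⊕ δ (suc a) ≋ δ (next n (suc a)) ⊕ δ a
  step-middle {a} p≤sa sa≤p+k = by-Im (Im-resp (λ j → ring (δ (suc a) j) (δ (next n (suc a)) j) (δ a j))
    (Im-row-at (≤p+k⇒<n sa≤p+k) (toNext-from-p p≤sa) (toPrev-below-p+k sa≤p+k)))
    where
    ring : ∀ x s r → + 1 *ᶻ (x -ᶻ s) +ᶻ + 1 *ᶻ (x -ᶻ r) ≡ (x +ᶻ x) -ᶻ (s +ᶻ r)
    ring = solve-∀

  step-high : ∀ {a} → p + k ≤ a → suc a < n → δ (suc a) ≋ δ (next n (suc a))
  step-high {a} p+k≤a sa<n = by-Im (Im-resp (λ j → ring (δ (suc a) j) (δ (next n (suc a)) j) (δ a j))
    (Im-row-at sa<n (toNext-from-p (ℕP.≤-trans (ℕP.m≤m+n p k) (ℕP.m≤n⇒m≤1+n p+k≤a)))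
                    (toPrev-from-p+k p+k≤a)))
    where
    ring : ∀ x s r → + 1 *ᶻ (x -ᶻ s) +ᶻ + 0 *ᶻ (x -ᶻ r) ≡ x -ᶻ s
    ring = solve-∀

  low≋0 : ∀ a → a < p → δ a ≋ δ 0
  low≋0 zero    _   = ≋-refl
  low≋0 (suc a) a<p = ≋-trans (step-low a<p) (low≋0 a (ℕP.<-trans (ℕP.n<1+n a) a<p))

  next-high : ∀ t a → suc (a + t) ≡ n → p + k ≤ a → δ (next n a) ≋ δ 0
  next-high zero    a ends _ =
    ≗⇒≋ (λ j → cong (λ b → δ b j) (next-last (trans (cong suc (sym (ℕP.+-identityʳ a))) ends)))
  next-high (suc t) a ends p+k≤a = begin
    δ (next n a)        ≡⟨ cong δ (next-inner sa<n) ⟩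
    δ (suc a)           ≈⟨ step-high p+k≤a sa<n ⟩
    δ (next n (suc a))  ≈⟨ next-high t (suc a) (trans (cong suc (sym (ℕP.+-suc a t))) ends) (ℕP.m≤n⇒m≤1+n p+k≤a) ⟩
    δ 0                 ∎
    where
    open ≋-Reasoning
    sa<n : suc a < n
    sa<n = subst (suc a <_) ends (s≤s (ℕP.m<m+n a z<s))

  next≋0 : ∀ {a} → p + k ≤ a → a < n → δ (next n a) ≋ δ 0
  next≋0 {a} p+k≤a a<n = next-high (n ∸ suc a) a (ℕP.m+[n∸m]≡n a<n) p+k≤a

  high≋0 : ∀ {a} → p + k < a → a < n → δ a ≋ δ 0
  high≋0 {suc a} (s≤s p+k≤a) sa<n = ≋-trans (step-high p+k≤a sa<n) (next≋0 (ℕP.m≤n⇒m≤1+n p+k≤a) sa<n)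

  d : Vecℤ n
  d = δ p ⊖ δ 0

  δ0≋δ0⊕0·d : δ 0 ≋ δ 0 ⊕ scale (+ 0) d
  δ0≋δ0⊕0·d = ≗⇒≋ (λ j → pad (δ 0 j) (d j))
    where
    pad : ∀ x y → x ≡ x +ᶻ + 0 *ᶻ y
    pad = solve-∀

  progression-pair : ∀ m → m ≤ k →
                     δ (m + p′) ≋ δ 0 ⊕ scale (+ m) d × δ (suc m + p′) ≋ δ 0 ⊕ scale (+ suc m) d
  progression-pair zero _ =
    ≋-trans (low≋0 p′ (ℕP.n<1+n p′)) δ0≋δ0⊕0·d , ≗⇒≋ (λ j → first (δ p j) (δ 0 j))
    where
    first : ∀ x y → x ≡ y +ᶻ + 1 *ᶻ (x -ᶻ y)
    first = solve-∀
  progression-pair (suc m) m<k with progression-pair m (ℕP.<⇒≤ m<k)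
  ... | δm≋ , δsm≋ = δsm≋ , extrapolate {P = δ 0} {d = d} (+ m) δm≋ δsm≋ harmonic
    where
    harmonic : δ (suc m + p′) ⊕ δ (suc m + p′) ≋ δ (suc (suc m) + p′) ⊕ δ (m + p′)
    harmonic = subst (λ b → δ (suc m + p′) ⊕ δ (suc m + p′) ≋ δ b ⊕ δ (m + p′))
                     (next-inner (≤p+k⇒<n (inner-bound m<k)))
                     (step-middle (s≤s (ℕP.m≤n+m p′ m)) (ℕP.<⇒≤ (inner-bound m<k)))

  progression : ∀ m → m ≤ suc k → δ (m + p′) ≋ δ 0 ⊕ scale (+ m) d
  progression zero    _         = proj₁ (progression-pair 0 z≤n)
  progression (suc m) (s≤s m≤k) = proj₂ (progression-pair m m≤k)

  K·d≋0 : scale (+ K) d ≋ 0ᵥ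
  K·d≋0 = ⊕-cancelˡ {x = δ 0} (begin
    δ 0 ⊕ scale (+ K) d      ≈⟨ extrapolate {P = δ 0} {d = d} (+ k) (progression k (ℕP.n≤1+n k))
                                            (progression (suc k) ℕP.≤-refl) top ⟨
    δ (next n (suc k + p′))  ≈⟨ next≋0 top≥p+k (≤p+k⇒<n top≤p+k) ⟩
    δ 0                      ≈⟨ ≗⇒≋ (λ j → sym (ℤP.+-identityʳ (δ 0 j))) ⟩
    δ 0 ⊕ 0ᵥ                 ∎)
    where
    open ≋-Reasoning
    top : δ (suc k + p′) ⊕ δ (suc k + p′) ≋ δ (next n (suc k + p′)) ⊕ δ (k + p′)
    top = step-middle (s≤s (ℕP.m≤n+m p′ k)) top≤p+k

  data Vertex : ℕ → Set where
    low   : ∀ {a} → a < p → Vertex a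
    inner : ∀ {m} → m < k → Vertex (suc m + p′)
    top   : Vertex (suc k + p′)
    high  : ∀ {a} → p + k < a → a < n → Vertex a

  vertex : ∀ {a} → a < n → Vertex a
  vertex {a} a<n with a ℕ.<? p | p + k ℕ.<? a
  ... | yes a<p | _         = low a<p
  ... | no _    | yes p+k<a = high p+k<a a<n
  ... | no a≮p  | no p+k≮a  = subst Vertex a≡ (middle (a ∸ p) m≤k)
    where
    a≡ : suc (a ∸ p) + p′ ≡ a
    a≡ = trans (sym (ℕP.+-suc (a ∸ p) p′)) (ℕP.m∸n+n≡m (ℕP.≮⇒≥ a≮p))
    m≤k : a ∸ p ≤ k
    m≤k = subst (a ∸ p ≤_) (ℕP.m+n∸m≡n p k) (ℕP.∸-monoˡ-≤ p (ℕP.≮⇒≥ p+k≮a))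
    middle : ∀ m → m ≤ k → Vertex (suc m + p′)
    middle m m≤k with ℕP.m≤n⇒m<n∨m≡n m≤k
    ... | inj₁ m<k  = inner m<k
    ... | inj₂ refl = top

  c : ℕ → ℤ
  c a = if a <ᵇ p then + 0 else (if p + k <ᵇ a then + 0 else + (a ∸ p′))

  c-low : ∀ {a} → a < p → c a ≡ + 0
  c-low {a} a<p rewrite dec-true (a ℕ.<? p) a<p = refl

  c-high : ∀ {a} → p + k < a → c a ≡ + 0
  c-high {a} p+k<a
    rewrite dec-false (a ℕ.<? p) (ℕP.≤⇒≯ (ℕP.≤-trans (ℕP.m≤m+n p k) (ℕP.<⇒≤ p+k<a)))
          | dec-true (p + k ℕ.<? a) p+k<a = refl

  c-progression : ∀ m → m ≤ suc k → c (m + p′) ≡ + m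
  c-progression zero    _ = c-low (ℕP.n<1+n p′)
  c-progression (suc m) (s≤s m≤k)
    rewrite dec-false (suc m + p′ ℕ.<? p) (ℕP.≤⇒≯ (s≤s (ℕP.m≤n+m p′ m)))
          | dec-false (p + k ℕ.<? suc m + p′) (ℕP.≤⇒≯ (stretch-bound m≤k))
          = cong +_ (ℕP.m+n∸n≡m (suc m) p′)

  c-next-high : ∀ {a} → p + k ≤ a → a < n → c (next n a) ≡ + 0
  c-next-high {a} p+k≤a a<n with suc a ℕ.≟ n
  ... | yes sa≡n = trans (cong c (next-last sa≡n)) (c-low z<s)
  ... | no  sa≢n = trans (cong c (next-inner (ℕP.≤∧≢⇒< a<n sa≢n))) (c-high (s≤s p+k≤a))

  ≡0⇒K∣ : ∀ {z} → z ≡ + 0 → + K ∣ z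
  ≡0⇒K∣ refl = ∣0

  balance : ℕ → ℤ
  balance a = toNext a *ᶻ (c a -ᶻ c (next n a)) +ᶻ toPrev a *ᶻ (c a -ᶻ c (prev n a))

  balance-at : ∀ a {F B x s r} → toNext a ≡ F → toPrev a ≡ B →
               c a ≡ x → c (next n a) ≡ s → c (prev n a) ≡ r →
               balance a ≡ F *ᶻ (x -ᶻ s) +ᶻ B *ᶻ (x -ᶻ r)
  balance-at a refl refl refl refl refl = refl

  K∣balance : ∀ {a} → Vertex a → + K ∣ balance a
  K∣balance (low {zero} 0<p) =
    ≡0⇒K∣ (trans (balance-at 0 (toNext-low 0<p) toPrev-zero refl refl refl) (isolated (c 0) (c (next n 0)) (c (n ∸ 1))))
    where
    isolated : ∀ x s r → + 0 *ᶻ (x -ᶻ s) +ᶻ + 0 *ᶻ (x -ᶻ r) ≡ + 0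
    isolated = solve-∀
  K∣balance (low {suc a} sa<p) =
    ≡0⇒K∣ (trans (balance-at (suc a) (toNext-low sa<p) refl (c-low sa<p) refl
                             (c-low (ℕP.<-trans (ℕP.n<1+n a) sa<p)))
                 (flat (c (next n (suc a))) (toPrev (suc a))))
    where
    flat : ∀ s B → + 0 *ᶻ (+ 0 -ᶻ s) +ᶻ B *ᶻ (+ 0 -ᶻ + 0) ≡ + 0
    flat = solve-∀
  K∣balance (inner {m} m<k) =
    ≡0⇒K∣ (trans (balance-at (suc m + p′) (toNext-from-p (s≤s (ℕP.m≤n+m p′ m)))
                             (toPrev-below-p+k (ℕP.<⇒≤ (inner-bound m<k)))
                             (c-progression (suc m) (s≤s (ℕP.<⇒≤ m<k))) c-next
                             (c-progression m (ℕP.m≤n⇒m≤1+n (ℕP.<⇒≤ m<k))))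
                 (harmonic (+ m)))
    where
    c-next : c (next n (suc m + p′)) ≡ + suc (suc m)
    c-next = trans (cong c (next-inner (≤p+k⇒<n (inner-bound m<k)))) (c-progression (suc (suc m)) (s≤s m<k))
    harmonic : ∀ x → + 1 *ᶻ ((+ 1 +ᶻ x) -ᶻ (+ 2 +ᶻ x)) +ᶻ + 1 *ᶻ ((+ 1 +ᶻ x) -ᶻ x) ≡ + 0
    harmonic = solve-∀
  K∣balance top =
    subst (+ K ∣_) (sym (trans (balance-at (suc k + p′) (toNext-from-p (s≤s (ℕP.m≤n+m p′ k)))
                                           (toPrev-below-p+k top≤p+k) (c-progression (suc k) ℕP.≤-refl)
                                           (c-next-high top≥p+k (≤p+k⇒<n top≤p+k))
                                           (c-progression k (ℕP.n≤1+n k)))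
                               (peak (+ k))))
          ∣-refl
    where
    peak : ∀ x → + 1 *ᶻ ((+ 1 +ᶻ x) -ᶻ + 0) +ᶻ + 1 *ᶻ ((+ 1 +ᶻ x) -ᶻ x) ≡ + 2 +ᶻ x
    peak = solve-∀
  K∣balance (high {suc a} (s≤s p+k≤a) sa<n) =
    ≡0⇒K∣ (trans (balance-at (suc a) (toNext-from-p (ℕP.≤-trans (ℕP.m≤m+n p k) (ℕP.m≤n⇒m≤1+n p+k≤a)))
                             (toPrev-from-p+k p+k≤a) (c-high (s≤s p+k≤a))
                             (c-next-high (ℕP.m≤n⇒m≤1+n p+k≤a) sa<n) refl)
                 (flat (c a)))
    where
    flat : ∀ r → + 1 *ᶻ (+ 0 -ᶻ + 0) +ᶻ + 0 *ᶻ (+ 0 -ᶻ r) ≡ + 0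
    flat = solve-∀

  δ≋ : ∀ {a} → Vertex a → δ a ≋ δ 0 ⊕ scale (c a) d
  δ≋ (low {a} a<p) = subst (λ z → δ a ≋ δ 0 ⊕ scale z d) (sym (c-low a<p))
                           (≋-trans (low≋0 a a<p) δ0≋δ0⊕0·d)
  δ≋ (inner {m} m<k) = subst (λ z → δ (suc m + p′) ≋ δ 0 ⊕ scale z d) (sym (c-progression (suc m) sm≤sk))
                             (progression (suc m) sm≤sk)
    where
    sm≤sk = s≤s (ℕP.<⇒≤ m<k)
  δ≋ top = subst (λ z → δ (suc k + p′) ≋ δ 0 ⊕ scale z d) (sym (c-progression (suc k) ℕP.≤-refl))
                 (progression (suc k) ℕP.≤-refl)
  δ≋ (high {a} p+k<a a<n) = subst (λ z → δ a ≋ δ 0 ⊕ scale z d) (sym (c-high p+k<a))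
                                  (≋-trans (high≋0 p+k<a a<n) δ0≋δ0⊕0·d)

  𝟙 : ℕ → ℤ
  𝟙 _ = + 1

  degree-row : ∀ i → ⟨ 𝟙 , laplacian G i ⟩ ≡ + 0
  degree-row i = trans (⟨⟩-laplacian 𝟙 i)
                       (trans (⟨⟩-row 𝟙 (toℕ<n i)) (ring (toNext (toℕ i)) (toPrev (toℕ i))))
    where
    ring : ∀ F B → F *ᶻ (+ 1 -ᶻ + 1) +ᶻ B *ᶻ (+ 1 -ᶻ + 1) ≡ + 0
    ring = solve-∀

  K∣c-row : ∀ i → + K ∣ ⟨ c , laplacian G i ⟩
  K∣c-row i = subst (+ K ∣_) (sym (trans (⟨⟩-laplacian c i) (⟨⟩-row c (toℕ<n i))))
                    (K∣balance (vertex (toℕ<n i)))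

  ⟨𝟙,d⟩≡0 : ⟨ 𝟙 , d ⟩ ≡ + 0
  ⟨𝟙,d⟩≡0 = trans (⟨⟩-⊖ 𝟙 (δ {n} p) (δ 0)) (cong₂ _-ᶻ_ (⟨⟩-δ 𝟙 p<n) (⟨⟩-δ {n} 𝟙 z<s))

  ⟨c,d⟩≡1 : ⟨ c , d ⟩ ≡ + 1
  ⟨c,d⟩≡1 = trans (⟨⟩-⊖ c (δ {n} p) (δ 0))
                  (cong₂ _-ᶻ_ (trans (⟨⟩-δ c p<n) (c-progression 1 (s≤s z≤n))) (⟨⟩-δ {n} c z<s))

  normal-form-δ : ∀ (v : Fin n) → δ (toℕ v) ≋ scale (+ 1) (δ 0) ⊕ scale (c (toℕ v)) d
  normal-form-δ v = ≋-trans (δ≋ (vertex (toℕ<n v)))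
    (≗⇒≋ (λ j → cong (_+ᶻ scale (c (toℕ v)) d j) (sym (ℤP.*-identityˡ (δ 0 j)))))

  open Presentation K 𝟙 c (δ 0) d degree-row K∣c-row (⟨⟩-δ {n} 𝟙 z<s) (⟨⟩-δ {n} c z<s)
                    ⟨𝟙,d⟩≡0 ⟨c,d⟩≡1 K·d≋0 normal-form-δ

  numBi≡k : numBi G ≡ k
  numBi≡k = begin
    numBi G                                         ≡⟨ numBi≡count n h ⟩
    count (p + k + q) bi?                           ≡⟨ count-+ (p + k) q bi? ⟩
    count (p + k) bi? + count q (shift (p + k))     ≡⟨ cong₂ _+_ (count-+ p k bi?) none-high ⟩
    count p bi? + count k (shift p) + 0             ≡⟨ cong (λ z → z + count k (shift p) + 0) none-low ⟩
    count k (shift p) + 0                           ≡⟨ cong (λ z → z + 0) all-middle ⟩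
    k + 0                                           ≡⟨ ℕP.+-identityʳ k ⟩
    k                                               ∎
    where
    open ≡-Reasoning
    bi? : ℕ → Bool
    bi? x = isBi (h x)
    shift : ℕ → ℕ → Bool
    shift a x = bi? (a + x)
    none-low : count p bi? ≡ 0
    none-low = count-none p bi? (λ x x<p → cong isBi (h-low x<p))
    all-middle : count k (shift p) ≡ k
    all-middle = count-all k (shift p) (λ x x<k → cong isBi (h-middle (ℕP.m≤m+n p x) (ℕP.+-monoʳ-< p x<k)))
    none-high : count q (shift (p + k)) ≡ 0
    none-high = count-none q (shift (p + k)) (λ x _ → cong isBi (h-high (ℕP.m≤m+n (p + k) x)))

  pic×jac : Pic≅ G (ℤ×ℤmod (numBi G + 2)) × Jac≅ G (ℤmod (numBi G + 2))
  pic×jac = subst (λ m → Pic≅ G (ℤ×ℤmod m) × Jac≅ G (ℤmod m)) (sym numBi+2≡K) (picIso , jacIso)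
    where
    numBi+2≡K : numBi G + 2 ≡ K
    numBi+2≡K = trans (cong (λ z → z + 2) numBi≡k) (ℕP.+-comm k 2)

theorem4p12 : (n p q : ℕ) → 3 ≤ n → 1 ≤ p → 1 ≤ q → p + q ≤ n →
    Pic≅ (twoOpposite n p q) (ℤ×ℤmod (numBi (twoOpposite n p q) + 2))
    × Jac≅ (twoOpposite n p q) (ℤmod (numBi (twoOpposite n p q) + 2))
theorem4p12 n (suc p′) (suc q′) _ (s≤s z≤n) (s≤s z≤n) p+q≤n =
  subst (λ m → Pic≅ (twoOpposite m p q) (ℤ×ℤmod (numBi (twoOpposite m p q) + 2))
             × Jac≅ (twoOpposite m p q) (ℤmod (numBi (twoOpposite m p q) + 2)))
        p+k+q≡n (TwoOppositePaths.pic×jac p′ k q′)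
  where
  p q k : ℕ
  p = suc p′
  q = suc q′
  k = n ∸ (p + q)
  p+k+q≡n : p + k + q ≡ n
  p+k+q≡n = begin
    p + k + q    ≡⟨ ℕP.+-assoc p k q ⟩
    p + (k + q)  ≡⟨ cong (λ z → p + z) (ℕP.+-comm k q) ⟩
    p + (q + k)  ≡⟨ ℕP.+-assoc p q k ⟨
    p + q + k    ≡⟨ ℕP.m+[n∸m]≡n p+q≤n ⟩
    n            ∎
    where open ≡-Reasoning
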